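{- Let $k \geq 2$ be a natural number and let $G$ be a finite graph of average degree at least $2k$ and girth $g$. Then $G$ contains a cycle of length at least $(g-2)k + 2$ which has at least one chord.
   Context: The average degree of a graph $G$ is $2|E(G)|/|V(G)|$. The girth of $G$ is the length of a shortest cycle in $G$. A chord of a cycle $C$ in $G$ is an edge of $G$ joining two vertices of $C$ that is not an edge of $C$. -}

module Defs where

open import Level using (0ℓ)
open import Data.Nat using (ℕ; zero; suc; _+_; _*_; _∸_; _≤_)
open import Data.Fin using (Fin; toℕ; _<_; _<?_)
open import Data.List using (List; map; allFin)
open import Data.Nat.ListAction using (sum)
open import Data.Product using (Σ; _×_; _,_; ∃; ∃-syntax)
open import Data.Sum using (_⊎_)
open import Data.Bool using (if_then_else_)
open import Relation.Nullary using (¬_; Dec)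
open import Relation.Nullary.Decidable using (⌊_⌋; _×-dec_)
open import Relation.Binary.PropositionalEquality using (_≡_)
open import Function.Definitions using (Injective)

record Graph (n : ℕ) : Set₁ where
  field
    Adj    : Fin n → Fin n → Set
    adj?   : ∀ i j → Dec (Adj i j)
    sym    : ∀ {i j} → Adj i j → Adj j i
    irrefl : ∀ {i} → ¬ Adj i i

open Graph public

edgeCount : ∀ {n} → Graph n → ℕ
edgeCount {n} G =
  sum (map (λ i → sum (map (λ j → if ⌊ (i <? j) ×-dec adj? G i j ⌋ then 1 else 0)
                           (allFin n)))
           (allFin n))

-- average degree 2|E|/|V| is at least d  (with |V| ≥ 1 so the average is defined)
AvgDegreeAtLeast : ∀ {n} → Graph n → ℕ → Set
AvgDegreeAtLeast {n} G d = 1 ≤ n × d * n ≤ 2 * edgeCount G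

Consec : (L : ℕ) → Fin L → Fin L → Set
Consec L i j = toℕ j ≡ suc (toℕ i) ⊎ (suc (toℕ i) ≡ L × toℕ j ≡ 0)

record Cycle {n : ℕ} (G : Graph n) (L : ℕ) : Set where
  field
    len≥3 : 3 ≤ L
    vert  : Fin L → Fin n
    inj   : Injective _≡_ _≡_ vert
    edges : ∀ i j → Consec L i j → Adj G (vert i) (vert j)

open Cycle public

HasChord : ∀ {n} {G : Graph n} {L} → Cycle G L → Set
HasChord {G = G} {L} C =
  ∃[ i ] ∃[ j ] (Adj G (vert C i) (vert C j) × ¬ Consec L i j × ¬ Consec L j i)

HasGirth : ∀ {n} → Graph n → ℕ → Set
HasGirth G g = Cycle G g × (∀ L → Cycle G L → g ≤ L)

{-# OPTIONS --safe #-}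
-- Deleting vertices of degree at most k keeps 2k·|V| ≤ 2|E|, so G has a nonempty induced
-- subgraph H of minimum degree at least k + 1, and the cycles of H, being cycles of G, have
-- length at least g.  Let x₀x₁…x_ℓ be a path of H that cannot be extended at x₀: all the
-- k + 1 ≥ 3 neighbours of x₀ lie on it, at indices i ≥ 1.  Neighbours x_i, x_j with i < j
-- close the cycle x₀x_i…x_j of length j − i + 2 ≥ g, so neighbour indices are at least g − 2
-- apart and the last one, p, exceeds k(g − 2).  The cycle x₀x₁…x_p has length p + 1 ≥
-- (g − 2)k + 2, and the edge from x₀ to the second-to-last neighbour x_q (q ≥ 2) is a chord.
module Submission where

open import Defs hiding (sym)
open import Data.Nat using (ℕ; zero; suc; _+_; _*_; _∸_; _≤_; _<_; z≤n; s≤s)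
open import Data.Nat.Properties hiding (_<?_)
open import Data.Fin as Fin using (Fin; toℕ; punchIn; _<?_)
import Data.Fin.Properties as Fin
open import Data.List using (map; allFin; tabulate)
open import Data.List.Properties using (map-tabulate)
import Data.Nat.ListAction as List
open import Algebra.Properties.CommutativeMonoid.Sum +-0-commutativeMonoid
  using (sum; sum-cong-≗; sum-remove; sum-replicate-zero; ∑-distrib-+; ∑-comm)
open import Data.Product using (Σ; _×_; _,_; ∃; ∃-syntax)
open import Data.Sum using (inj₁; inj₂)
open import Data.Bool using (Bool; true; false; if_then_else_)
open import Relation.Nullary using (¬_; Dec; yes; no; contradiction)
open import Relation.Nullary.Decidable using (⌊_⌋; _×-dec_; ¬?; decidable-stable)
open import Relation.Binary.PropositionalEquality
open import Relation.Binary.Definitions using (tri<; tri≈; tri>)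
open import Function.Definitions using (Injective)

sum-mono-≤ : ∀ {n} {f g : Fin n → ℕ} → (∀ i → f i ≤ g i) → sum f ≤ sum g
sum-mono-≤ {zero}  f≤g = z≤n
sum-mono-≤ {suc n} f≤g = +-mono-≤ (f≤g Fin.zero) (sum-mono-≤ (λ i → f≤g (Fin.suc i)))

sum-zero : ∀ {n} {f : Fin n → ℕ} → (∀ i → f i ≡ 0) → sum f ≡ 0
sum-zero {n} f≡0 = trans (sum-cong-≗ f≡0) (sum-replicate-zero n)

sum-allFin : ∀ {n} (f : Fin n → ℕ) → List.sum (map f (allFin n)) ≡ sum f
sum-allFin {n} f = trans (cong List.sum (map-tabulate (λ i → i) f)) (sum-tabulate f)
  where
  sum-tabulate : ∀ {m} (g : Fin m → ℕ) → List.sum (tabulate g) ≡ sum g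
  sum-tabulate {zero}  g = refl
  sum-tabulate {suc m} g = cong (g Fin.zero +_) (sum-tabulate (λ i → g (Fin.suc i)))

δ : ∀ {n} → Fin n → Fin n → ℕ
δ v u = if ⌊ v Fin.≟ u ⌋ then 1 else 0

δ-diag : ∀ {n} (v : Fin n) → δ v v ≡ 1
δ-diag v with v Fin.≟ v
... | yes _   = refl
... | no v≢v = contradiction refl v≢v

δ-off : ∀ {n} {v u : Fin n} → v ≢ u → δ v u ≡ 0
δ-off {v = v} {u} v≢u with v Fin.≟ u
... | yes v≡u = contradiction v≡u v≢u
... | no _    = refl

sum-δ : ∀ {n} (v : Fin n) (g : Fin n → ℕ) → sum (λ u → δ v u * g u) ≡ g v
sum-δ {suc n} v g = begin
  sum (λ u → δ v u * g u)                                          ≡⟨ sum-remove {i = v} (λ u → δ v u * g u) ⟩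
  δ v v * g v + sum (λ j → δ v (punchIn v j) * g (punchIn v j))    ≡⟨ cong₂ _+_ (cong (_* g v) (δ-diag v)) (sum-zero off-v) ⟩
  g v + 0 + 0                                                      ≡⟨ trans (+-identityʳ _) (+-identityʳ _) ⟩
  g v                                                              ∎
  where
  open ≡-Reasoning
  off-v : ∀ j → δ v (punchIn v j) * g (punchIn v j) ≡ 0
  off-v j = cong (_* g (punchIn v j)) (δ-off (λ v≡ → Fin.punchInᵢ≢i v j (sym v≡)))

sumTo : (ℕ → ℕ) → ℕ → ℕ
sumTo F zero    = 0
sumTo F (suc m) = sumTo F m + F m

sumTo-cong : ∀ {F G : ℕ → ℕ} m → (∀ i → F i ≡ G i) → sumTo F m ≡ sumTo G m
sumTo-cong zero    F≡G = refl
sumTo-cong (suc m) F≡G = cong₂ _+_ (sumTo-cong m F≡G) (F≡G m)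

sumTo-term : ∀ (F : ℕ → ℕ) {i m} → i < m → F i ≤ sumTo F m
sumTo-term F {i} {suc m} (s≤s i≤m) with m≤n⇒m<n∨m≡n i≤m
... | inj₁ i<m  = ≤-trans (sumTo-term F i<m) (m≤m+n _ _)
... | inj₂ refl = m≤n+m _ _

sum-sumTo-comm : ∀ {n} (F : ℕ → Fin n → ℕ) m →
  sum (λ u → sumTo (λ i → F i u) m) ≡ sumTo (λ i → sum (F i)) m
sum-sumTo-comm {n} F zero    = sum-zero {n} (λ _ → refl)
sum-sumTo-comm     F (suc m) =
  trans (∑-distrib-+ _ (F m)) (cong (_+ sum (F m)) (sum-sumTo-comm F m))

sum≤sumTo-cover : ∀ {n} (w : Fin n → ℕ) (φ : ℕ → Fin n) m →
  (∀ u → w u ≢ 0 → ∃ λ i → i < m × φ i ≡ u) → sum w ≤ sumTo (λ i → w (φ i)) m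
sum≤sumTo-cover w φ m cover = begin
  sum w                                           ≤⟨ sum-mono-≤ covered ⟩
  sum (λ u → sumTo (λ i → δ (φ i) u * w u) m)     ≡⟨ sum-sumTo-comm (λ i u → δ (φ i) u * w u) m ⟩
  sumTo (λ i → sum (λ u → δ (φ i) u * w u)) m     ≡⟨ sumTo-cong m (λ i → sum-δ (φ i) w) ⟩
  sumTo (λ i → w (φ i)) m                         ∎
  where
  open ≤-Reasoning
  covered : ∀ u → w u ≤ sumTo (λ i → δ (φ i) u * w u) m
  covered u with w u ≟ 0
  ... | yes w≡0 = ≤-trans (≤-reflexive w≡0) z≤n
  ... | no w≢0 with cover u w≢0
  ...   | i , i<m , refl = subst (_≤ sumTo (λ j → δ (φ j) (φ i) * w (φ i)) m) δw≡w
                                 (sumTo-term (λ j → δ (φ j) (φ i) * w (φ i)) i<m)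
    where
    δw≡w : δ (φ i) (φ i) * w (φ i) ≡ w (φ i)
    δw≡w = trans (cong (_* w (φ i)) (δ-diag (φ i))) (+-identityʳ _)

adj : ∀ {n} → Graph n → Fin n → Fin n → ℕ
adj G i j = if ⌊ adj? G i j ⌋ then 1 else 0

degree : ∀ {n} → Graph n → Fin n → ℕ
degree G i = sum (adj G i)

degreeSum : ∀ {n} → Graph n → ℕ
degreeSum G = sum (degree G)

adj-sym : ∀ {n} (G : Graph n) i j → adj G i j ≡ adj G j i
adj-sym G i j with adj? G i j | adj? G j i
... | yes _  | yes _  = refl
... | no _   | no _   = refl
... | yes ij | no ¬ji = contradiction (Graph.sym G ij) ¬ji
... | no ¬ij | yes ji = contradiction (Graph.sym G ji) ¬ij

adj-irrefl : ∀ {n} (G : Graph n) i → adj G i i ≡ 0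
adj-irrefl G i with adj? G i i
... | yes ii = contradiction ii (irrefl G)
... | no _   = refl

Adj-if-adj≢0 : ∀ {n} (G : Graph n) {i j} → adj G i j ≢ 0 → Adj G i j
Adj-if-adj≢0 G {i} {j} adj≢0 with adj? G i j
... | yes ij = ij
... | no _   = contradiction refl adj≢0

orientedEdge : ∀ {n} → Graph n → Fin n → Fin n → ℕ
orientedEdge G i j = if ⌊ (i <? j) ×-dec adj? G i j ⌋ then 1 else 0

orientedEdge-pair : ∀ {n} (G : Graph n) i j → orientedEdge G i j + orientedEdge G j i ≡ adj G i j
orientedEdge-pair G i j with adj? G i j | adj? G j i | i <? j | j <? i
... | yes _  | yes _  | yes i<j | yes j<i = contradiction j<i (Fin.<-asym i<j)
... | yes _  | yes _  | yes _   | no _    = refl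
... | yes _  | yes _  | no _    | yes _   = refl
... | yes ij | yes _  | no i≮j  | no j≮i  with Fin.<-cmp i j
...   | tri< i<j _ _ = contradiction i<j i≮j
...   | tri≈ _ refl _ = contradiction ij (irrefl G)
...   | tri> _ _ j<i = contradiction j<i j≮i
orientedEdge-pair G i j | yes ij | no ¬ji | _ | _ = contradiction (Graph.sym G ij) ¬ji
orientedEdge-pair G i j | no ¬ij | yes ji | _ | _ = contradiction (Graph.sym G ji) ¬ij
orientedEdge-pair G i j | no _   | no _   | yes _ | yes _ = refl
orientedEdge-pair G i j | no _   | no _   | yes _ | no _  = refl
orientedEdge-pair G i j | no _   | no _   | no _  | yes _ = refl
orientedEdge-pair G i j | no _   | no _   | no _  | no _  = refl

handshake : ∀ {n} (G : Graph n) → 2 * edgeCount G ≡ degreeSum G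
handshake {n} G = begin
  2 * edgeCount G                                     ≡⟨ cong (λ e → e + (e + 0)) edgeCount≡ ⟩
  E + (E + 0)                                         ≡⟨ cong (E +_) (trans (+-identityʳ E) (∑-comm (orientedEdge G))) ⟩
  E + sum (λ i → sum (λ j → orientedEdge G j i))      ≡⟨ ∑-distrib-+ (λ i → sum (orientedEdge G i)) _ ⟨
  sum (λ i → sum (orientedEdge G i) + sum (λ j → orientedEdge G j i))
                                                      ≡⟨ sum-cong-≗ (λ i → ∑-distrib-+ (orientedEdge G i) _) ⟨
  sum (λ i → sum (λ j → orientedEdge G i j + orientedEdge G j i))
                                                      ≡⟨ sum-cong-≗ (λ i → sum-cong-≗ (orientedEdge-pair G i)) ⟩
  degreeSum G                                         ∎
  where
  open ≡-Reasoning
  E = sum (λ i → sum (orientedEdge G i))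
  edgeCount≡ : edgeCount G ≡ E
  edgeCount≡ = trans (sum-allFin {n} _) (sum-cong-≗ (λ i → sum-allFin (orientedEdge G i)))

induced : ∀ {m n} → Graph n → (Fin m → Fin n) → Graph m
induced G ι = record
  { Adj    = λ i j → Adj G (ι i) (ι j)
  ; adj?   = λ i j → adj? G (ι i) (ι j)
  ; sym    = Graph.sym G
  ; irrefl = irrefl G
  }

removeVertex : ∀ {n} → Graph (suc n) → Fin (suc n) → Graph n
removeVertex G v = induced G (punchIn v)

degreeSum-removeVertex : ∀ {n} (G : Graph (suc n)) v →
  degreeSum G ≡ degree G v + degree G v + degreeSum (removeVertex G v)
degreeSum-removeVertex G v = begin
  degreeSum G                                                    ≡⟨ sum-remove {i = v} (degree G) ⟩
  degree G v + sum (λ j → degree G (punchIn v j))                ≡⟨ cong (degree G v +_) (sum-cong-≗ degree-punchIn) ⟩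
  degree G v + sum (λ j → adj G v (punchIn v j) + degree G′ j)   ≡⟨ cong (degree G v +_) (∑-distrib-+ (λ j → adj G v (punchIn v j)) (degree G′)) ⟩
  degree G v + (sum (λ j → adj G v (punchIn v j)) + degreeSum G′) ≡⟨ cong (λ d → degree G v + (d + degreeSum G′)) degree-v ⟨
  degree G v + (degree G v + degreeSum G′)                        ≡⟨ +-assoc (degree G v) _ _ ⟨
  degree G v + degree G v + degreeSum G′                          ∎
  where
  open ≡-Reasoning
  G′ = removeVertex G v
  degree-v : degree G v ≡ sum (λ j → adj G v (punchIn v j))
  degree-v = trans (sum-remove {i = v} (adj G v)) (cong (_+ sum (λ j → adj G v (punchIn v j))) (adj-irrefl G v))
  degree-punchIn : ∀ j → degree G (punchIn v j) ≡ adj G v (punchIn v j) + degree G′ j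
  degree-punchIn j = trans (sum-remove {i = v} (adj G (punchIn v j))) (cong (_+ degree G′ j) (adj-sym G _ v))

MinDegreeAtLeast : ∀ {n} → Graph n → ℕ → Set
MinDegreeAtLeast G d = ∀ i → d ≤ degree G i

record MinDegreeSubgraph {n} (G : Graph n) (d : ℕ) : Set where
  field
    m         : ℕ
    embed     : Fin (suc m) → Fin n
    injective : Injective _≡_ _≡_ embed
    minDegree : MinDegreeAtLeast (induced G embed) d

MinDegreeSubgraph-induced : ∀ {m n} {G : Graph n} {ι : Fin m → Fin n} {d} →
  Injective _≡_ _≡_ ι → MinDegreeSubgraph (induced G ι) d → MinDegreeSubgraph G d
MinDegreeSubgraph-induced ι-inj H = record
  { m = m ; embed = _ ; injective = λ e → injective (ι-inj e) ; minDegree = minDegree }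
  where open MinDegreeSubgraph H

degreeSum-singleton : (G : Graph 1) → degreeSum G ≡ 0
degreeSum-singleton G = cong (λ a → a + 0 + 0) (adj-irrefl G Fin.zero)

minDegreeSubgraph : ∀ {n} (G : Graph (suc n)) {k} → 1 ≤ k →
  2 * k * suc n ≤ degreeSum G → MinDegreeSubgraph G (suc k)
minDegreeSubgraph {zero} G {k} 1≤k dense =
  contradiction (subst (2 * k * 1 ≤_) (degreeSum-singleton G) dense)
                (<⇒≱ (*-mono-≤ (*-mono-≤ {1} {2} (s≤s z≤n) 1≤k) (≤-refl {1})))
minDegreeSubgraph {suc n} G {k} 1≤k dense with Fin.all? (λ i → suc k ≤? degree G i)
... | yes all = record { m = suc n ; embed = λ i → i ; injective = λ e → e ; minDegree = all }
... | no ¬all with Fin.¬∀⟶∃¬ _ _ (λ i → suc k ≤? degree G i) ¬all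
...   | v , ¬k<deg = MinDegreeSubgraph-induced (λ {i j} → Fin.punchIn-injective v i j)
                       (minDegreeSubgraph (removeVertex G v) 1≤k
                         (peel (subst (2 * k * suc (suc n) ≤_) (degreeSum-removeVertex G v) dense) (≮⇒≥ ¬k<deg)))
  where
  peel : ∀ {d s} → 2 * k * suc (suc n) ≤ d + d + s → d ≤ k → 2 * k * suc n ≤ s
  peel {d} {s} dense′ d≤k = +-cancelˡ-≤ (2 * k) _ _ (begin
    2 * k + 2 * k * suc n   ≡⟨ *-suc (2 * k) (suc n) ⟨
    2 * k * suc (suc n)     ≤⟨ dense′ ⟩
    d + d + s               ≤⟨ +-monoˡ-≤ s (+-mono-≤ d≤k (≤-trans d≤k (m≤m+n k 0))) ⟩
    2 * k + s               ∎)
    where open ≤-Reasoning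

count : (ℕ → Bool) → ℕ → ℕ
count h = sumTo (λ i → if h i then 1 else 0)

lastMark : ∀ h m {c} → suc c ≤ count h m → ∃ λ p → p < m × h p ≡ true × c ≤ count h p
lastMark h zero    ()
lastMark h (suc m) {c} marks with h m in hm
... | true  = m , ≤-refl , hm , ≤-pred (subst (suc c ≤_) (+-comm (count h m) 1) marks)
... | false with lastMark h m (subst (suc c ≤_) (+-identityʳ _) marks)
...   | p , p<m , hp , c≤count = p , m<n⇒m<1+n p<m , hp , c≤count

Separated : (ℕ → Bool) → ℕ → ℕ → Set
Separated h d m = ∀ {x y} → h x ≡ true → h y ≡ true → x < y → y < m → x + d ≤ y

count*gap<mark : ∀ {h d m} → h 0 ≡ false → Separated h d m →
  ∀ {c p} → c ≤ count h p → h p ≡ true → p < m → c * d < p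
count*gap<mark {h} {d} {m} h0 separated = spread
  where
  spread : ∀ {c p} → c ≤ count h p → h p ≡ true → p < m → c * d < p
  spread {zero}  {zero}  _ hp _ = contradiction (trans (sym h0) hp) λ ()
  spread {zero}  {suc p} _ _  _ = s≤s z≤n
  spread {suc c} {p} marks hp p<m with lastMark h p marks
  ... | q , q<p , hq , c≤count = begin-strict
    d + c * d   <⟨ +-monoʳ-< d (spread c≤count hq (<-trans q<p p<m)) ⟩
    d + q       ≡⟨ +-comm d q ⟩
    q + d       ≤⟨ separated hq hp q<p p<m ⟩
    p           ∎
    where open ≤-Reasoning

distantMarks : ∀ {h d m k} → h 0 ≡ false → Separated h d m → 1 ≤ d → 2 ≤ k → suc k ≤ count h m →
  ∃ λ p → ∃ λ q → p < m × h p ≡ true × h q ≡ true × 2 ≤ q × q < p × k * d < p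
distantMarks {h} {d} {m} {k} h0 separated 1≤d 2≤k marks with lastMark h m marks
... | p , p<m , hp , k≤count with lastMark h p (≤-trans 2≤k k≤count)
...   | q , q<p , hq , 1≤count = p , q , p<m , hp , hq , 2≤q , q<p , kd<p
  where
  kd<p : k * d < p
  kd<p = count*gap<mark h0 separated k≤count hp p<m
  2≤q : 2 ≤ q
  2≤q = ≤-<-trans (≤-trans 1≤d (m≤m+n d 0)) (count*gap<mark h0 separated 1≤count hq (<-trans q<p p<m))

record Path {n} (G : Graph n) : Set where
  field
    length         : ℕ
    node           : ℕ → Fin n
    node-injective : ∀ {i j} → i < length → j < length → node i ≡ node j → i ≡ j
    node-adjacent  : ∀ {i} → suc i < length → Adj G (node i) (node (suc i))

open Path

module _ {n} {G : Graph n} where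

  OnPath : Path G → Fin n → Set
  OnPath P u = ∃ λ i → i < length P × node P i ≡ u

  onPath? : ∀ P u → Dec (OnPath P u)
  onPath? P u = anyUpTo? (λ i → node P i Fin.≟ u) (length P)

  Unextendable : Path G → Set
  Unextendable P = ∀ {u} → Adj G (node P 0) u → OnPath P u

  singletonPath : Fin n → Path G
  singletonPath v = record
    { length = 1 ; node = λ _ → v
    ; node-injective = λ { (s≤s z≤n) (s≤s z≤n) _ → refl }
    ; node-adjacent  = λ { (s≤s ()) }
    }

  prepend : (P : Path G) {u : Fin n} → Adj G (node P 0) u → ¬ OnPath P u → Path G
  prepend P {u} x~u u∉P = record
    { length = suc (length P) ; node = node′ ; node-injective = injective′ ; node-adjacent = adjacent′ }
    where
    node′ : ℕ → Fin n
    node′ zero    = u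
    node′ (suc i) = node P i
    injective′ : ∀ {i j} → i < suc (length P) → j < suc (length P) → node′ i ≡ node′ j → i ≡ j
    injective′ {zero}  {zero}  _        _        _  = refl
    injective′ {zero}  {suc j} _        (s≤s j<) u≡ = contradiction (j , j< , sym u≡) u∉P
    injective′ {suc i} {zero}  (s≤s i<) _        ≡u = contradiction (i , i< , ≡u) u∉P
    injective′ {suc i} {suc j} (s≤s i<) (s≤s j<) eq = cong suc (node-injective P i< j< eq)
    adjacent′ : ∀ {i} → suc i < suc (length P) → Adj G (node′ i) (node′ (suc i))
    adjacent′ {zero}  _       = Graph.sym G x~u
    adjacent′ {suc i} (s≤s i+1<) = node-adjacent P i+1<

  length≤n : (P : Path G) → length P ≤ n
  length≤n P with length P ≤? n
  ... | yes ≤n = ≤n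
  ... | no ≰n with Fin.pigeonhole (≰⇒> ≰n) (λ i → node P (toℕ i))
  ...   | i , j , i<j , eq = contradiction (node-injective P (Fin.toℕ<n i) (Fin.toℕ<n j) eq) (<⇒≢ i<j)

  extendFully : ∀ fuel (P : Path G) → n < length P + fuel → Σ (Path G) Unextendable
  extendFully zero P bound = contradiction (length≤n P) (<⇒≱ (subst (n <_) (+-identityʳ _) bound))
  extendFully (suc fuel) P bound
    with Fin.any? (λ u → adj? G (node P 0) u ×-dec ¬? (onPath? P u))
  ... | yes (u , x~u , u∉P) = extendFully fuel (prepend P x~u u∉P) (subst (n <_) (+-suc _ fuel) bound)
  ... | no stuck = P , λ {u} x~u → decidable-stable (onPath? P u) (λ u∉P → stuck (u , x~u , u∉P))

  unextendablePath : Fin n → Σ (Path G) Unextendable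
  unextendablePath v = extendFully n (singletonPath v) ≤-refl

  closePath : (Q : Path G) → 3 ≤ length Q →
    (∀ {l} → suc l ≡ length Q → Adj G (node Q l) (node Q 0)) → Cycle G (length Q)
  closePath Q 3≤ closing = record
    { len≥3 = 3≤
    ; vert  = λ i → node Q (toℕ i)
    ; inj   = λ eq → Fin.toℕ-injective (node-injective Q (Fin.toℕ<n _) (Fin.toℕ<n _) eq)
    ; edges = edge
    }
    where
    edge : ∀ i j → Consec (length Q) i j → Adj G (node Q (toℕ i)) (node Q (toℕ j))
    edge i j (inj₁ j≡1+i) rewrite j≡1+i = node-adjacent Q (subst (_< length Q) j≡1+i (Fin.toℕ<n j))
    edge i j (inj₂ (last , j≡0)) rewrite j≡0 = closing last

  shortcut : (P : Path G) {i d : ℕ} → 1 ≤ i → i + d < length P → Adj G (node P 0) (node P i) → Path G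
  shortcut P {i} {d} 1≤i bound x~i = record
    { length = suc (suc d) ; node = node′ ; node-injective = injective′ ; node-adjacent = adjacent′ }
    where
    node′ : ℕ → Fin n
    node′ zero    = node P 0
    node′ (suc t) = node P (i + t)
    on-P : ∀ {t} → t < suc d → i + t < length P
    on-P (s≤s t≤d) = ≤-<-trans (+-monoʳ-≤ i t≤d) bound
    0<P : 0 < length P
    0<P = ≤-<-trans z≤n bound
    injective′ : ∀ {s t} → s < suc (suc d) → t < suc (suc d) → node′ s ≡ node′ t → s ≡ t
    injective′ {zero}  {zero}  _        _        _  = refl
    injective′ {zero}  {suc t} _        (s≤s t<) eq = contradiction (node-injective P 0<P (on-P t<) eq) (<⇒≢ (≤-trans 1≤i (m≤m+n i t)))
    injective′ {suc s} {zero}  (s≤s s<) _        eq = contradiction (node-injective P 0<P (on-P s<) (sym eq)) (<⇒≢ (≤-trans 1≤i (m≤m+n i s)))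
    injective′ {suc s} {suc t} (s≤s s<) (s≤s t<) eq = cong suc (+-cancelˡ-≡ i s t (node-injective P (on-P s<) (on-P t<) eq))
    adjacent′ : ∀ {t} → suc t < suc (suc d) → Adj G (node′ t) (node′ (suc t))
    adjacent′ {zero}  _ = subst (λ j → Adj G (node P 0) (node P j)) (sym (+-identityʳ i)) x~i
    adjacent′ {suc t} (s≤s t+1<) = subst (λ j → Adj G (node P (i + t)) (node P j)) (sym (+-suc i t))
                                     (node-adjacent P (subst (_< length P) (+-suc i t) (on-P t+1<)))

  shortcutCycle : (P : Path G) {i d : ℕ} → 1 ≤ i → 1 ≤ d → i + d < length P →
    Adj G (node P 0) (node P i) → Adj G (node P 0) (node P (i + d)) → Cycle G (suc (suc d))
  shortcutCycle P 1≤i 1≤d bound x~i x~i+d =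
    closePath (shortcut P 1≤i bound x~i) (s≤s (s≤s 1≤d)) λ { refl → Graph.sym G x~i+d }

module _ {n} {G : Graph n} (P : Path G) where

  neighbourAt : ℕ → Bool
  neighbourAt i = ⌊ adj? G (node P 0) (node P i) ⌋

  Adj-neighbourAt : ∀ {i} → neighbourAt i ≡ true → Adj G (node P 0) (node P i)
  Adj-neighbourAt {i} marked with adj? G (node P 0) (node P i)
  ... | yes x~i = x~i
  ... | no _    = contradiction marked λ ()

  neighbourAt-0 : neighbourAt 0 ≡ false
  neighbourAt-0 with adj? G (node P 0) (node P 0)
  ... | yes x~x = contradiction x~x (irrefl G)
  ... | no _    = refl

  degree≤count-neighbourAt : Unextendable P → degree G (node P 0) ≤ count neighbourAt (length P)
  degree≤count-neighbourAt unextendable =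
    sum≤sumTo-cover (adj G (node P 0)) (node P) (length P) (λ _ adj≢0 → unextendable (Adj-if-adj≢0 G adj≢0))

  neighbourAt-separated : ∀ {g} → (∀ L → Cycle G L → g ≤ L) → Separated neighbourAt (g ∸ 2) (length P)
  neighbourAt-separated {g} girth {i} {j} hi hj i<j j<ℓ = begin
    i + (g ∸ 2)  ≤⟨ +-monoʳ-≤ i (∸-monoˡ-≤ 2 (girth _ cycle)) ⟩
    i + (j ∸ i)  ≡⟨ j≡ ⟩
    j            ∎
    where
    open ≤-Reasoning
    j≡ : i + (j ∸ i) ≡ j
    j≡ = m+[n∸m]≡n (<⇒≤ i<j)
    1≤i : 1 ≤ i
    1≤i = n≢0⇒n>0 (λ { refl → contradiction (trans (sym neighbourAt-0) hi) λ () })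
    cycle : Cycle G (suc (suc (j ∸ i)))
    cycle = shortcutCycle P 1≤i (m<n⇒0<n∸m i<j) (subst (_< length P) (sym j≡) j<ℓ) (Adj-neighbourAt hi)
              (subst (λ t → Adj G (node P 0) (node P t)) (sym j≡) (Adj-neighbourAt hj))

  chordedCycle : ∀ {p q} → p < length P → neighbourAt p ≡ true → neighbourAt q ≡ true → 2 ≤ q → q < p →
    Σ (Cycle G (suc p)) HasChord
  chordedCycle {suc p} {suc q} p<ℓ hp hq (s≤s 1≤q) (s≤s q<p) = cycle , Fin.zero , j , x~j , ¬0→j , ¬j→0
    where
    x~1 : Adj G (node P 0) (node P 1)
    x~1 = node-adjacent P (≤-<-trans (s≤s z≤n) p<ℓ)
    cycle : Cycle G (suc (suc p))
    cycle = shortcutCycle P ≤-refl (≤-trans 1≤q (<⇒≤ q<p)) p<ℓ x~1 (Adj-neighbourAt hp)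
    q<L : suc q < suc (suc p)
    q<L = s≤s (s≤s (<⇒≤ q<p))
    j : Fin (suc (suc p))
    j = Fin.fromℕ< q<L
    toℕ-j : toℕ j ≡ suc q
    toℕ-j = Fin.toℕ-fromℕ< q<L
    x~j : Adj G (vert cycle Fin.zero) (vert cycle j)
    x~j = subst (λ t → Adj G (node P 0) (node (shortcut P ≤-refl p<ℓ x~1) t)) (sym toℕ-j) (Adj-neighbourAt hq)
    ¬0→j : ¬ Consec (suc (suc p)) Fin.zero j
    ¬0→j (inj₁ j≡1)   = contradiction (suc-injective (trans (sym toℕ-j) j≡1)) (≢-sym (<⇒≢ 1≤q))
    ¬0→j (inj₂ (() , _))
    ¬j→0 : ¬ Consec (suc (suc p)) j Fin.zero
    ¬j→0 (inj₁ ())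
    ¬j→0 (inj₂ (last , _)) = contradiction (trans (sym toℕ-j) (suc-injective last)) (<⇒≢ (s≤s q<p))

  unextendable⇒longChordedCycle : Unextendable P → ∀ {k g} → 2 ≤ k → 3 ≤ g → suc k ≤ degree G (node P 0) →
    (∀ L → Cycle G L → g ≤ L) → ∃[ L ] Σ (Cycle G L) (λ C → (g ∸ 2) * k + 2 ≤ L × HasChord C)
  unextendable⇒longChordedCycle unextendable {k} {g} 2≤k 3≤g k<degree girth =
    let p , q , p<ℓ , hp , hq , 2≤q , q<p , kd<p =
          distantMarks neighbourAt-0 (neighbourAt-separated girth) (∸-monoˡ-≤ 2 3≤g) 2≤k
            (≤-trans k<degree (degree≤count-neighbourAt unextendable))
        cycle , chord = chordedCycle p<ℓ hp hq 2≤q q<p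
        long : (g ∸ 2) * k + 2 ≤ suc p
        long = subst (_≤ suc p) (+-comm 2 ((g ∸ 2) * k)) (s≤s (subst (_< p) (*-comm k (g ∸ 2)) kd<p))
    in suc p , cycle , long , chord

embedCycle : ∀ {m n} {G : Graph n} {ι : Fin m → Fin n} → Injective _≡_ _≡_ ι →
  ∀ {L} → Cycle (induced G ι) L → Cycle G L
embedCycle {ι = ι} ι-injective C = record
  { len≥3 = len≥3 C ; vert = λ i → ι (vert C i) ; inj = λ eq → inj C (ι-injective eq) ; edges = edges C }

minDegreeSubgraph⇒longChordedCycle : ∀ {n} {G : Graph n} {k g} → 2 ≤ k → 3 ≤ g → (∀ L → Cycle G L → g ≤ L) →
  MinDegreeSubgraph G (suc k) → ∃[ L ] Σ (Cycle G L) (λ C → (g ∸ 2) * k + 2 ≤ L × HasChord C)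
minDegreeSubgraph⇒longChordedCycle {G = G} 2≤k 3≤g girth record { embed = ι ; injective = ι-injective ; minDegree = minDegree } =
  let P , unextendable = unextendablePath {G = induced G ι} Fin.zero
      L , C , long , chord = unextendable⇒longChordedCycle P unextendable 2≤k 3≤g (minDegree (node P 0))
                               (λ L C → girth L (embedCycle {G = G} ι-injective C))
  in L , embedCycle {G = G} ι-injective C , long , chord

lemma3 : (k : ℕ) → 2 ≤ k → ∀ {n} (G : Graph n) (g : ℕ) →
    AvgDegreeAtLeast G (2 * k) → HasGirth G g →
    ∃[ L ] Σ (Cycle G L) (λ C → (g ∸ 2) * k + 2 ≤ L × HasChord C)
lemma3 k 2≤k {zero}  G g (() , _) _
lemma3 k 2≤k {suc n} G g (_ , dense) (shortest , girth) =
  minDegreeSubgraph⇒longChordedCycle 2≤k (len≥3 shortest) girth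
    (minDegreeSubgraph G (≤-trans (s≤s z≤n) 2≤k) (subst (2 * k * suc n ≤_) (handshake G) dense))
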